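{- Let $G=(V,A)$ be a finite directed graph, $I\subseteq V$ and $\Lambda$ a non-negative integer. Then among the sets $P\subseteq V\setminus I$ with $|P|\le\Lambda$ maximizing the number of saved vertices, there is one satisfying $P\subseteq\mathcal C$.
   Context: Given $I$ and a protected set $P\subseteq V\setminus I$, a vertex is infected iff it belongs to $I$ or can be reached from a vertex of $I$ by a directed path in the subgraph $G[V\setminus P]$ induced by $V\setminus P$; the other vertices are saved. For $v\in V\setminus I$, let $S(v)$ be the set of saved vertices when $P=\{v\}$. A vertex $v\in V\setminus I$ is a candidate if it can be reached from a vertex of $I$ by a directed path and $S(v)$ is maximal with respect to inclusion among the sets $S(u)$, $u\in V\setminus I$ (i.e. there is no $u\in V\setminus I$ with $S(v)\subsetneq S(u)$). $\mathcal C$ denotes the set of candidate vertices. -}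

module Defs where

open import Data.Nat using (ℕ; _≤_)
open import Data.Bool using (Bool; true)
open import Data.Fin using (Fin)
open import Data.Fin.Subset using (Subset; _∈_; _∉_; ⁅_⁆; ⊥; ∣_∣)
open import Data.Product using (Σ; ∃; _×_)
open import Data.Sum using (_⊎_)
open import Relation.Nullary using (¬_)
open import Relation.Binary.PropositionalEquality using (_≡_)

-- A finite directed graph G = (V, A) with V = Fin n; A u w ≡ true iff (u,w) is an arc.
Digraph : ℕ → Set
Digraph n = Fin n → Fin n → Bool

-- Directed path from u to v in the induced subgraph G[V \ P]
-- (every vertex of the path, including both ends, lies outside P).
data PathAvoid {n : ℕ} (G : Digraph n) (P : Subset n) : Fin n → Fin n → Set where
  stop : ∀ {u} → u ∉ P → PathAvoid G P u u
  step : ∀ {u w v} → u ∉ P → G u w ≡ true → PathAvoid G P w v → PathAvoid G P u v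

Infected : {n : ℕ} → Digraph n → (I P : Subset n) → Fin n → Set
Infected G I P v = v ∈ I ⊎ ∃ λ u → u ∈ I × PathAvoid G P u v

Saved : {n : ℕ} → Digraph n → (I P : Subset n) → Fin n → Set
Saved G I P v = ¬ Infected G I P v

IsSavedSet : {n : ℕ} → Digraph n → (I P S : Subset n) → Set
IsSavedSet G I P S = ∀ v → (v ∈ S → Saved G I P v) × (Saved G I P v → v ∈ S)

S : {n : ℕ} → Digraph n → (I : Subset n) → Fin n → Fin n → Set
S G I v = Saved G I ⁅ v ⁆

StrictSub : {n : ℕ} → (Fin n → Set) → (Fin n → Set) → Set
StrictSub X Y = (∀ w → X w → Y w) × ∃ λ w → Y w × ¬ X w

ReachableFrom : {n : ℕ} → Digraph n → Subset n → Fin n → Set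
ReachableFrom G I v = ∃ λ u → u ∈ I × PathAvoid G ⊥ u v

Candidate : {n : ℕ} → Digraph n → Subset n → Fin n → Set
Candidate G I v =
  v ∉ I × ReachableFrom G I v ×
  ¬ (∃ λ u → u ∉ I × StrictSub (S G I v) (S G I u))

Admissible : {n : ℕ} → Subset n → ℕ → Subset n → Set
Admissible I Λ P = (∀ v → v ∈ P → v ∉ I) × ∣ P ∣ ≤ Λ

module Submission where

open import Defs
open import Data.Nat using (ℕ; _≤_)
open import Data.Fin using (Fin)
open import Data.Fin.Subset using (Subset; _∈_; ∣_∣)
open import Data.Product using (∃; _×_)

-- Call a protection set optimal if it is admissible and saves
-- at least as many vertices as every admissible set, and give each vertex x
-- the cost 1 + |V \ S(x)|.  Among the optimal sets choose one, P, of least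
-- total cost.  Every v ∈ P is a candidate, by an exchange argument.  If v
-- were unreachable from I, then P - v would still save everything P saves;
-- if S(v) ⊊ S(u) for some u ∉ I, then so would (P - v) ∪ {u}, because a
-- path from I to v avoiding u would infect v even when u alone is
-- protected.  Both sets are admissible and strictly cheaper than P (since
-- cost u < cost v in the second case), contradicting the choice of P.

open import Data.Nat using (zero; suc; _+_; _<_; z≤n; s≤s)
open import Data.Nat.Properties as ℕP
  using (≤-refl; ≤-trans; ≤-antisym; <-≤-trans; <⇒≱; n≮0; ≤-pred; m≤n+m; m<n+m; +-monoʳ-≤; +-monoˡ-<; +-monoˡ-≤)
open import Algebra.Properties.CommutativeSemigroup ℕP.+-commutativeSemigroup using (x∙yz≈y∙xz)
open import Data.Fin using (zero; suc; _≟_)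
open import Data.Fin.Properties using (any?; all?)
open import Data.Fin.Subset using (inside; outside; _∉_; _⊆_; _⊂_; ⁅_⁆; ∁; _∪_; _-_) renaming (⊥ to ∅)
open import Data.Fin.Subset.Properties
  using (_∈?_; ∉⊥; ⊥⊆; ∣⊥∣≡0; ∣p∣≤n; x∈⁅x⁆; x∈⁅y⁆⇒x≡y; ⊆-antisym; p⊆q⇒∣p∣≤∣q∣; p⊂q⇒∣p∣<∣q∣;
         p⊂q⇒∁p⊃∁q; x∈p⇒x∉∁p; x∈∁p⇒x∉p; x∉p⇒x∈∁p; p⊆p∪q; q⊆p∪q; x∈p∪q⁻; ∪-identityʳ;
         p─⊥≡p; p─q⊆p; ∣p─q∣≤∣p∣; x∈p∧x≢y⇒x∈p-y)
open import Data.Bool using (true) renaming (_≟_ to _≟ᵇ_)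
open import Data.Vec using ([]; _∷_; here; there)
open import Data.Product using (_,_; proj₁; proj₂)
open import Data.Sum using (_⊎_; inj₁; inj₂; [_,_])
open import Data.Empty using (⊥-elim)
open import Relation.Nullary using (¬_; Dec; yes; no; does)
open import Relation.Nullary.Decidable using (_×-dec_; _⊎-dec_; _→-dec_; map′; ¬?)
open import Relation.Unary using (Pred; Decidable)
open import Relation.Binary.Bundles using (TotalPreorder)
open import Relation.Binary.Construct.Flip.EqAndOrd using (totalPreorder)
open import Relation.Binary.PropositionalEquality using (_≡_; _≢_; refl; sym; cong; subst; module ≡-Reasoning)
open import Function using (_∘_)

private
  variable
    n : ℕ

∁-shrinks : ∀ {u} {P : Subset n} → u ∉ P → ∁ (P ∪ ⁅ u ⁆) ⊂ ∁ P
∁-shrinks {u = u} {P} u∉P =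
  (λ z∈ → x∉p⇒x∈∁p (λ z∈P → x∈∁p⇒x∉p z∈ (p⊆p∪q ⁅ u ⁆ z∈P))) ,
  u , x∉p⇒x∈∁p u∉P , x∈p⇒x∉∁p (q⊆p∪q P ⁅ u ⁆ (x∈⁅x⁆ u))

∉-∪⁅⁆ : ∀ {z u} {P : Subset n} → z ∉ P → z ≢ u → z ∉ P ∪ ⁅ u ⁆
∉-∪⁅⁆ {u = u} {P} z∉P z≢u z∈ = [ z∉P , z≢u ∘ x∈⁅y⁆⇒x≡y u ] (x∈p∪q⁻ P ⁅ u ⁆ z∈)

weight : (Fin n → ℕ) → Subset n → ℕ
weight w []            = 0
weight w (inside ∷ p)  = w zero + weight (w ∘ suc) p
weight w (outside ∷ p) = weight (w ∘ suc) p

∣p∣≡weight1 : (p : Subset n) → ∣ p ∣ ≡ weight (λ _ → 1) p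
∣p∣≡weight1 []            = refl
∣p∣≡weight1 (inside ∷ p)  = cong suc (∣p∣≡weight1 p)
∣p∣≡weight1 (outside ∷ p) = ∣p∣≡weight1 p

weight-remove : (w : Fin n → ℕ) {x : Fin n} {p : Subset n} →
  x ∈ p → w x + weight w (p - x) ≡ weight w p
weight-remove w {zero} {inside ∷ p} here =
  cong (λ q → w zero + weight (w ∘ suc) q) (p─⊥≡p p)
weight-remove w {suc x} {inside ∷ p} (there x∈p) = begin
  w (suc x) + (w zero + weight (w ∘ suc) (p - x)) ≡⟨ x∙yz≈y∙xz (w (suc x)) (w zero) _ ⟩
  w zero + (w (suc x) + weight (w ∘ suc) (p - x)) ≡⟨ cong (w zero +_) (weight-remove (w ∘ suc) x∈p) ⟩
  w zero + weight (w ∘ suc) p                     ∎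
  where open ≡-Reasoning
weight-remove w {suc x} {outside ∷ p} (there x∈p) = weight-remove (w ∘ suc) x∈p

weight-add : (w : Fin n → ℕ) (y : Fin n) (p : Subset n) →
  weight w (p ∪ ⁅ y ⁆) ≤ w y + weight w p
weight-add w zero (inside ∷ p) rewrite ∪-identityʳ p = m≤n+m _ (w zero)
weight-add w zero (outside ∷ p) rewrite ∪-identityʳ p = ≤-refl
weight-add w (suc y) (inside ∷ p) = begin
  w zero + weight (w ∘ suc) (p ∪ ⁅ y ⁆) ≤⟨ +-monoʳ-≤ (w zero) (weight-add (w ∘ suc) y p) ⟩
  w zero + (w (suc y) + weight (w ∘ suc) p) ≡⟨ x∙yz≈y∙xz (w zero) (w (suc y)) _ ⟩
  w (suc y) + (w zero + weight (w ∘ suc) p) ∎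
  where open ℕP.≤-Reasoning
weight-add w (suc y) (outside ∷ p) = weight-add (w ∘ suc) y p

weight-exchange-≤ : (w : Fin n → ℕ) {x : Fin n} {p : Subset n} (y : Fin n) →
  x ∈ p → w y ≤ w x → weight w ((p - x) ∪ ⁅ y ⁆) ≤ weight w p
weight-exchange-≤ w {x} {p} y x∈p wy≤wx = begin
  weight w ((p - x) ∪ ⁅ y ⁆) ≤⟨ weight-add w y (p - x) ⟩
  w y + weight w (p - x)   ≤⟨ +-monoˡ-≤ (weight w (p - x)) wy≤wx ⟩
  w x + weight w (p - x)   ≡⟨ weight-remove w x∈p ⟩
  weight w p               ∎
  where open ℕP.≤-Reasoning

weight-exchange-< : (w : Fin n → ℕ) {x : Fin n} {p : Subset n} (y : Fin n) →
  x ∈ p → w y < w x → weight w ((p - x) ∪ ⁅ y ⁆) < weight w p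
weight-exchange-< w {x} {p} y x∈p wy<wx = begin-strict
  weight w ((p - x) ∪ ⁅ y ⁆) ≤⟨ weight-add w y (p - x) ⟩
  w y + weight w (p - x)   <⟨ +-monoˡ-< (weight w (p - x)) wy<wx ⟩
  w x + weight w (p - x)   ≡⟨ weight-remove w x∈p ⟩
  weight w p               ∎
  where open ℕP.≤-Reasoning

∣p-x∪⁅y⁆∣≤∣p∣ : ∀ {x} {p : Subset n} (y : Fin n) → x ∈ p → ∣ (p - x) ∪ ⁅ y ⁆ ∣ ≤ ∣ p ∣
∣p-x∪⁅y⁆∣≤∣p∣ {x = x} {p} y x∈p
  rewrite ∣p∣≡weight1 ((p - x) ∪ ⁅ y ⁆) | ∣p∣≡weight1 p = weight-exchange-≤ (λ _ → 1) y x∈p ≤-refl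

toSubset : ∀ {ℓ} {P : Pred (Fin n) ℓ} → Decidable P → Subset n
toSubset {n = zero}  P? = []
toSubset {n = suc n} P? = does (P? zero) ∷ toSubset (P? ∘ suc)

toSubset-sound : ∀ {ℓ} {P : Pred (Fin n) ℓ} (P? : Decidable P) {x} → x ∈ toSubset P? → P x
toSubset-sound P? {zero} x∈ with P? zero
... | yes p = p
toSubset-sound P? {suc x} (there x∈) = toSubset-sound (P? ∘ suc) x∈

toSubset-complete : ∀ {ℓ} {P : Pred (Fin n) ℓ} (P? : Decidable P) {x} → P x → x ∈ toSubset P?
toSubset-complete P? {zero} p with P? zero
... | yes _  = here
... | no ¬p = ⊥-elim (¬p p)
toSubset-complete P? {suc x} p = there (toSubset-complete (P? ∘ suc) p)

module _ {a ℓ₁ ℓ₂} (T : TotalPreorder a ℓ₁ ℓ₂) where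
  open TotalPreorder T using (Carrier; _≲_; total) renaming (refl to ≲-refl; trans to ≲-trans)

  optimum-or-empty : ∀ {m q} {Q : Pred (Subset m) q} → Decidable Q → (f : Subset m → Carrier) →
    (∀ p → ¬ Q p) ⊎ ∃ λ p → Q p × (∀ p′ → Q p′ → f p′ ≲ f p)
  optimum-or-empty {zero} Q? f with Q? []
  ... | yes q = inj₂ ([] , q , λ { [] _ → ≲-refl })
  ... | no ¬q = inj₁ λ { [] → ¬q }
  optimum-or-empty {suc m} Q? f
    with optimum-or-empty (Q? ∘ (inside ∷_)) (f ∘ (inside ∷_))
       | optimum-or-empty (Q? ∘ (outside ∷_)) (f ∘ (outside ∷_))
  ... | inj₁ noIn | inj₁ noOut = inj₁ λ { (inside ∷ p) → noIn p ; (outside ∷ p) → noOut p }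
  ... | inj₂ (p , q , best) | inj₁ noOut =
    inj₂ (inside ∷ p , q , λ { (inside ∷ p′) q′ → best p′ q′ ; (outside ∷ p′) q′ → ⊥-elim (noOut p′ q′) })
  ... | inj₁ noIn | inj₂ (p , q , best) =
    inj₂ (outside ∷ p , q , λ { (outside ∷ p′) q′ → best p′ q′ ; (inside ∷ p′) q′ → ⊥-elim (noIn p′ q′) })
  ... | inj₂ (p , q , bestIn) | inj₂ (r , q′ , bestOut) with total (f (inside ∷ p)) (f (outside ∷ r))
  ...   | inj₁ p≲r = inj₂ (outside ∷ r , q′ ,
            λ { (inside ∷ p′) q″ → ≲-trans (bestIn p′ q″) p≲r ; (outside ∷ p′) q″ → bestOut p′ q″ })
  ...   | inj₂ r≲p = inj₂ (inside ∷ p , q ,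
            λ { (inside ∷ p′) q″ → bestIn p′ q″ ; (outside ∷ p′) q″ → ≲-trans (bestOut p′ q″) r≲p })

  optimum : ∀ {m q} {Q : Pred (Subset m) q} → Decidable Q → (f : Subset m → Carrier) →
    ∃ Q → ∃ λ p → Q p × (∀ p′ → Q p′ → f p′ ≲ f p)
  optimum Q? f (p₀ , q₀) with optimum-or-empty Q? f
  ... | inj₁ empty = ⊥-elim (empty p₀ q₀)
  ... | inj₂ best  = best

module Paths (G : Digraph n) where

  path-start∉ : ∀ {Q x y} → PathAvoid G Q x y → x ∉ Q
  path-start∉ (stop x∉) = x∉
  path-start∉ (step x∉ _ _) = x∉

  path-end∉ : ∀ {Q x y} → PathAvoid G Q x y → y ∉ Q
  path-end∉ (stop y∉) = y∉
  path-end∉ (step _ _ p) = path-end∉ p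

  path-weaken : ∀ {Q R x y} → R ⊆ Q → PathAvoid G Q x y → PathAvoid G R x y
  path-weaken R⊆Q (stop x∉) = stop (x∉ ∘ R⊆Q)
  path-weaken R⊆Q (step x∉ e p) = step (x∉ ∘ R⊆Q) e (path-weaken R⊆Q p)

  path-through : ∀ {Q R v x w} → (∀ {z} → z ∈ R → z ≢ v → z ∈ Q) →
    PathAvoid G Q x w → PathAvoid G R x w ⊎ PathAvoid G Q x v
  path-through {v = v} R⊆Q∪v (stop {z} z∉) with z ≟ v
  ... | yes refl = inj₂ (stop z∉)
  ... | no z≢v  = inj₁ (stop (λ z∈R → z∉ (R⊆Q∪v z∈R z≢v)))
  path-through {v = v} R⊆Q∪v (step {z} z∉ e p) with z ≟ v
  ... | yes refl = inj₂ (stop z∉)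
  ... | no z≢v  = [ inj₁ ∘ step (λ z∈R → z∉ (R⊆Q∪v z∈R z≢v)) e , inj₂ ∘ step z∉ e ]
                    (path-through R⊆Q∪v p)

  -- Cutting a path at its last visit to u: what remains avoids Q ∪ {u}.
  last-visit : ∀ {Q x w} u → PathAvoid G Q x w →
    PathAvoid G (Q ∪ ⁅ u ⁆) x w ⊎ (u ≡ w ⊎ ∃ λ y → G u y ≡ true × PathAvoid G (Q ∪ ⁅ u ⁆) y w)
  last-visit u (stop {x} x∉) with x ≟ u
  ... | yes refl = inj₂ (inj₁ refl)
  ... | no x≢u  = inj₁ (stop (∉-∪⁅⁆ x∉ x≢u))
  last-visit u (step {x} x∉ e p) with last-visit u p
  ... | inj₂ after = inj₂ after
  ... | inj₁ p′ with x ≟ u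
  ...   | yes refl = inj₂ (inj₂ (_ , e , p′))
  ...   | no x≢u  = inj₁ (step (∉-∪⁅⁆ x∉ x≢u) e p′)

  first-step : ∀ {Q u v} → PathAvoid G Q u v → u ≢ v →
    ∃ λ w → G u w ≡ true × PathAvoid G (Q ∪ ⁅ u ⁆) w v
  first-step (stop _) u≢v = ⊥-elim (u≢v refl)
  first-step {u = u} (step _ e p) u≢v with last-visit u p
  ... | inj₁ p′           = _ , e , p′
  ... | inj₂ (inj₁ u≡v)   = ⊥-elim (u≢v u≡v)
  ... | inj₂ (inj₂ after) = after

  -- Reachability in G[V \ P] is decidable: by induction on the number k of
  -- unprotected vertices, a path from u ≠ v is an arc u → w followed by a
  -- path from w avoiding P ∪ {u}.
  path?-within : ∀ k P → ∣ ∁ P ∣ ≤ k → ∀ u v → Dec (PathAvoid G P u v)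
  path?-within k P bound u v with u ∈? P | u ≟ v
  ... | yes u∈P | _        = no (λ p → path-start∉ p u∈P)
  ... | no u∉P  | yes refl = yes (stop u∉P)
  path?-within zero P bound u v | no u∉P | no _ =
    ⊥-elim (n≮0 (<-≤-trans (p⊂q⇒∣p∣<∣q∣ (∁-shrinks u∉P)) bound))
  path?-within (suc k) P bound u v | no u∉P | no u≢v =
    map′ (λ (w , e , p) → step u∉P e (path-weaken (p⊆p∪q ⁅ u ⁆) p))
         (λ p → first-step p u≢v)
         (any? λ w → (G u w ≟ᵇ true) ×-dec path?-within k (P ∪ ⁅ u ⁆) bound′ w v)
    where
      bound′ : ∣ ∁ (P ∪ ⁅ u ⁆) ∣ ≤ k
      bound′ = ≤-pred (<-≤-trans (p⊂q⇒∣p∣<∣q∣ (∁-shrinks u∉P)) bound)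

  path? : ∀ P u v → Dec (PathAvoid G P u v)
  path? P = path?-within n P (∣p∣≤n (∁ P))

module Infection (G : Digraph n) (I : Subset n) where
  open Paths G

  reached? : ∀ P v → Dec (∃ λ u → u ∈ I × PathAvoid G P u v)
  reached? P v = any? λ u → (u ∈? I) ×-dec path? P u v

  saved : Subset n → Subset n
  saved P = toSubset (λ v → ¬? ((v ∈? I) ⊎-dec reached? P v))

  saved-correct : ∀ P → IsSavedSet G I P (saved P)
  saved-correct P v = toSubset-sound _ , toSubset-complete _

  saved-unique : ∀ {P SP} → IsSavedSet G I P SP → SP ≡ saved P
  saved-unique {P} isSaved =
    ⊆-antisym (λ {v} v∈ → proj₂ (saved-correct P v) (proj₁ (isSaved v) v∈))
              (λ {v} v∈ → proj₂ (isSaved v) (proj₁ (saved-correct P v) v∈))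

  saved-⊆ : ∀ {P Q} → (∀ {z} → Saved G I P z → Saved G I Q z) → saved P ⊆ saved Q
  saved-⊆ {P} {Q} P⇒Q {z} z∈ = proj₂ (saved-correct Q z) (P⇒Q (proj₁ (saved-correct P z) z∈))

  saved-exchange : ∀ {R Q v} → (∀ {z} → z ∈ R → z ≢ v → z ∈ Q) →
    (∀ {x} → x ∈ I → ¬ PathAvoid G Q x v) →
    ∀ {z} → Saved G I R z → Saved G I Q z
  saved-exchange R⊆Q∪v shielded savedR (inj₁ z∈I) = savedR (inj₁ z∈I)
  saved-exchange R⊆Q∪v shielded savedR (inj₂ (x , x∈I , p)) =
    [ (λ p′ → savedR (inj₂ (x , x∈I , p′))) , shielded x∈I ] (path-through R⊆Q∪v p)

  shielded-by : ∀ {Q u v} → u ∈ Q → S G I u v → ∀ {x} → x ∈ I → ¬ PathAvoid G Q x v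
  shielded-by {u = u} u∈Q v∈S[u] x∈I p =
    v∈S[u] (inj₂ (_ , x∈I , path-weaken (λ z∈⁅u⁆ → subst (_∈ _) (sym (x∈⁅y⁆⇒x≡y u z∈⁅u⁆)) u∈Q) p))

  unreachable-shielded : ∀ {Q v} → ¬ ReachableFrom G I v → ∀ {x} → x ∈ I → ¬ PathAvoid G Q x v
  unreachable-shielded unreachable x∈I p = unreachable (_ , x∈I , path-weaken ⊥⊆ p)

  saved-itself : ∀ {v} → v ∉ I → S G I v v
  saved-itself {v} v∉I (inj₁ v∈I) = v∉I v∈I
  saved-itself {v} v∉I (inj₂ (_ , _ , p)) = path-end∉ p (x∈⁅x⁆ v)

  admissible? : ∀ Λ P → Dec (Admissible I Λ P)
  admissible? Λ P = all? (λ v → (v ∈? P) →-dec ¬? (v ∈? I)) ×-dec (∣ P ∣ ℕP.≤? Λ)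

module Exchange (G : Digraph n) (I : Subset n) (Λ : ℕ) where
  open Infection G I

  cost : Fin n → ℕ
  cost x = suc ∣ ∁ (saved ⁅ x ⁆) ∣

  strict⇒cost< : ∀ {u v} → StrictSub (S G I v) (S G I u) → cost u < cost v
  strict⇒cost< {u} {v} (S[v]⊆S[u] , y , y∈S[u] , y∉S[v]) =
    s≤s (p⊂q⇒∣p∣<∣q∣ (p⊂q⇒∁p⊃∁q saved⁅v⁆⊂saved⁅u⁆))
    where
      saved⁅v⁆⊂saved⁅u⁆ : saved ⁅ v ⁆ ⊂ saved ⁅ u ⁆
      saved⁅v⁆⊂saved⁅u⁆ = saved-⊆ (S[v]⊆S[u] _) , y ,
        proj₂ (saved-correct ⁅ u ⁆ y) y∈S[u] , y∉S[v] ∘ proj₁ (saved-correct ⁅ v ⁆ y)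

  Optimal : Subset n → Set
  Optimal P = Admissible I Λ P × (∀ P′ → Admissible I Λ P′ → ∣ saved P′ ∣ ≤ ∣ saved P ∣)

  Cheapest : Subset n → Set
  Cheapest P = Optimal P × (∀ P′ → Optimal P′ → weight cost P ≤ weight cost P′)

  ∅-admissible : Admissible I Λ ∅
  ∅-admissible = (λ _ v∈∅ → ⊥-elim (∉⊥ v∈∅)) , subst (_≤ Λ) (sym (∣⊥∣≡0 n)) z≤n

  cheapest-exists : ∃ Cheapest
  cheapest-exists
    with optimum ℕP.≤-totalPreorder (admissible? Λ) (λ P → ∣ saved P ∣) (∅ , ∅-admissible)
  ... | P₁ , adm₁ , max₁
    with optimum (totalPreorder ℕP.≤-totalPreorder)
                 (λ P → admissible? Λ P ×-dec (∣ saved P ∣ ℕP.≟ ∣ saved P₁ ∣)) (weight cost)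
                 (P₁ , adm₁ , refl)
  ... | P₂ , (adm₂ , same-count) , min₂ =
    P₂ , (adm₂ , λ P′ adm′ → subst (∣ saved P′ ∣ ≤_) (sym same-count) (max₁ P′ adm′)) ,
    λ P′ (adm′ , max′) → min₂ P′ (adm′ , ≤-antisym (max₁ P′ adm′) (max′ P₁ adm₁))

  unimprovable : ∀ {P Q} → Cheapest P → Admissible I Λ Q →
    (∀ {z} → Saved G I P z → Saved G I Q z) → ¬ weight cost Q < weight cost P
  unimprovable ((admP , maxP) , minP) admQ P⇒Q =
    λ Q<P → <⇒≱ Q<P (minP _ (admQ , λ P′ adm′ → ≤-trans (maxP P′ adm′) (p⊆q⇒∣p∣≤∣q∣ (saved-⊆ P⇒Q))))

  drop-admissible : ∀ {P v} → Admissible I Λ P → Admissible I Λ (P - v)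
  drop-admissible {P} {v} (P∩I=∅ , ∣P∣≤Λ) =
    (λ z z∈ → P∩I=∅ z (p─q⊆p P ⁅ v ⁆ z∈)) , ≤-trans (∣p─q∣≤∣p∣ P ⁅ v ⁆) ∣P∣≤Λ

  swap-admissible : ∀ {P v u} → v ∈ P → u ∉ I → Admissible I Λ P → Admissible I Λ ((P - v) ∪ ⁅ u ⁆)
  swap-admissible {P} {v} {u} v∈P u∉I (P∩I=∅ , ∣P∣≤Λ) =
    (λ z z∈ → [ P∩I=∅ z ∘ p─q⊆p P ⁅ v ⁆ , (λ z∈⁅u⁆ → subst (_∉ I) (sym (x∈⁅y⁆⇒x≡y u z∈⁅u⁆)) u∉I) ]
                (x∈p∪q⁻ (P - v) ⁅ u ⁆ z∈)) ,
    ≤-trans (∣p-x∪⁅y⁆∣≤∣p∣ u v∈P) ∣P∣≤Λ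

  cheapest⇒candidate : ∀ {P} → Cheapest P → ∀ v → v ∈ P → Candidate G I v
  cheapest⇒candidate {P} cheapest v v∈P = v∉I , reachable , maximal
    where
      admP = proj₁ (proj₁ cheapest)
      v∉I = proj₁ admP v v∈P

      -- Otherwise P - v saves as much as P and is cheaper.
      reachable : ReachableFrom G I v
      reachable with reached? ∅ v
      ... | yes r = r
      ... | no unreachable = ⊥-elim (unimprovable cheapest (drop-admissible admP)
              (saved-exchange x∈p∧x≢y⇒x∈p-y (unreachable-shielded unreachable))
              (subst (weight cost (P - v) <_) (weight-remove cost v∈P) (m<n+m _ (s≤s z≤n))))

      -- Otherwise (P - v) ∪ {u} saves as much as P and is cheaper.
      maximal : ¬ ∃ λ u → u ∉ I × StrictSub (S G I v) (S G I u)
      maximal (u , u∉I , S[v]⊊S[u]) = unimprovable cheapest (swap-admissible v∈P u∉I admP)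
        (saved-exchange (λ z∈P z≢v → p⊆p∪q ⁅ u ⁆ (x∈p∧x≢y⇒x∈p-y z∈P z≢v))
                        (shielded-by (q⊆p∪q (P - v) ⁅ u ⁆ (x∈⁅x⁆ u)) (proj₁ S[v]⊊S[u] v (saved-itself v∉I))))
        (weight-exchange-< cost u v∈P (strict⇒cost< S[v]⊊S[u]))

lemma5 : (n : ℕ) (G : Digraph n) (I : Subset n) (Λ : ℕ) →
    ∃ λ P → ∃ λ SP →
    Admissible I Λ P × IsSavedSet G I P SP ×
    (∀ P′ SP′ → Admissible I Λ P′ → IsSavedSet G I P′ SP′ → ∣ SP′ ∣ ≤ ∣ SP ∣) ×
    (∀ v → v ∈ P → Candidate G I v)
lemma5 n G I Λ = P , saved P , admP , saved-correct P , maxP , cheapest⇒candidate cheapest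
  where
    open Infection G I
    open Exchange G I Λ
    P = proj₁ cheapest-exists
    cheapest = proj₂ cheapest-exists
    admP = proj₁ (proj₁ cheapest)

    maxP : ∀ P′ SP′ → Admissible I Λ P′ → IsSavedSet G I P′ SP′ → ∣ SP′ ∣ ≤ ∣ saved P ∣
    maxP P′ SP′ adm′ isSaved = subst (λ X → ∣ X ∣ ≤ ∣ saved P ∣) (sym (saved-unique isSaved))
                                     (proj₂ (proj₁ cheapest) P′ adm′)
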